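{- The statistic of proximity $\mathsf{CN}$ has targeted sensitivity $\Delta(\mathsf{CN})\le 1$.
   Context: Graphs are undirected on a fixed vertex set $V$ with fixed partition $V=\mathcal{P}\cup\mathcal{T}$. For a graph $G$ and vertex $v$, $D_v(G)$ is the set of edges incident to $v$. Graphs $G,G'$ are neighboring ($G\sim G'$) if there is $v\in\mathcal{P}$ such that $D_{u}(G)\cup\{(v,u)\}=D_{u}(G')\cup\{(v,u)\}$ for all $u\ne v$. For a graph $G=(V,E)$, vertex $v$ and set $S$, $\mathsf{CN}(G,v,S)=|\{u: (v,u)\in E\text{ and }(u,v')\in E\text{ for some }v'\in S\}|$. The targeted sensitivity of a function $f(G,v,S)$ is $\Delta(f)=\max_{G\sim G',\,t\in\mathcal{T},\,S\subseteq\mathcal{T}}|f(G,t,S)-f(G',t,S)|$. -}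

module Defs where

open import Data.Nat using (ℕ; zero; suc; _+_)
open import Data.Bool using (Bool; true; false; _∧_; if_then_else_)
open import Data.Fin using (Fin)
open import Data.List using (List; map)
open import Data.Nat.ListAction using (sum)
open import Data.Bool.ListAction using (any)
open import Data.List using () renaming (allFin to allFinL)
open import Data.Product using (Σ; _×_)
open import Data.Sum using (_⊎_)
open import Relation.Binary.PropositionalEquality using (_≡_; _≢_)
open import Function.Bundles using (_⇔_)

-- Vertex set V = Fin n.  The partition V = P ∪ T is given by a Boolean
-- predicate isP : a vertex v is in P iff isP v ≡ true, in T iff isP v ≡ false.

record Graph (n : ℕ) : Set where
  field
    adj    : Fin n → Fin n → Bool
    sym    : ∀ a b → adj a b ≡ adj b a
    irrefl : ∀ a → adj a a ≡ false
open Graph public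

-- Edges are unordered pairs {a,b}; we represent them by ordered pairs (a,b)
-- and compare them as unordered pairs.
SameEdge : ∀ {n} → Fin n → Fin n → Fin n → Fin n → Set
SameEdge a b c d = (a ≡ c × b ≡ d) ⊎ (a ≡ d × b ≡ c)

InD : ∀ {n} → Graph n → Fin n → Fin n → Fin n → Set
InD G u a b = adj G a b ≡ true × (a ≡ u ⊎ b ≡ u)

Neighboring : ∀ {n} → (Fin n → Bool) → Graph n → Graph n → Set
Neighboring {n} isP G G' =
  Σ (Fin n) λ v → isP v ≡ true ×
    (∀ u → u ≢ v → ∀ a b →
       (InD G u a b ⊎ SameEdge a b v u) ⇔ (InD G' u a b ⊎ SameEdge a b v u))

SubsetOfT : ∀ {n} → (Fin n → Bool) → (Fin n → Bool) → Set
SubsetOfT {n} isP S = ∀ x → S x ≡ true → isP x ≡ false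

count : ∀ {n} → (Fin n → Bool) → ℕ
count {n} p = sum (map (λ u → if p u then 1 else 0) (allFinL n))

CN : ∀ {n} → Graph n → Fin n → (Fin n → Bool) → ℕ
CN {n} G v S =
  count (λ u → adj G v u ∧ any (λ v' → S v' ∧ adj G u v') (allFinL n))

module Submission where

open import Defs hiding (sym)
open import Data.Nat using (ℕ; zero; suc; _+_; _≤_; z≤n; s≤s; ∣_-_∣)
open import Data.Nat.Properties
  using (≤-refl; n≤1+n; m≤n+m; +-suc; +-monoʳ-≤; module ≤-Reasoning)
open import Data.Bool using (Bool; true; false; _∧_; if_then_else_)
open import Data.Bool.Properties using (⇔→≡)
open import Data.Bool.ListAction using (any; or)
open import Data.Fin using (Fin; zero; suc)
open import Data.Fin.Properties using (suc-injective)
open import Data.List using (allFin; map; tabulate)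
open import Data.List.Properties using (map-tabulate; map-cong)
open import Data.Nat.ListAction using (sum)
open import Data.Product using (_,_; proj₁)
open import Data.Sum using (_⊎_; inj₁; inj₂)
open import Data.Empty using (⊥-elim)
open import Function.Base using (id; _∘_)
open import Function.Bundles using (Equivalence; mk⇔)
open import Relation.Nullary using (¬_)
open import Relation.Binary.PropositionalEquality
  using (_≡_; _≢_; refl; sym; trans; cong; cong₂; module ≡-Reasoning)

-- The vertex v witnessing G ∼ G' lies in P, while t and the
-- vertices of S lie in T.  So G and G' agree on every pair of vertices other
-- than v, and whether a vertex u ≠ v is a common neighbour of t and S is
-- decided by such pairs only.  The two counts therefore differ in at most the
-- single vertex v.

indicator : Bool → ℕ
indicator b = if b then 1 else 0

indicator≤1 : ∀ b → indicator b ≤ 1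
indicator≤1 true  = ≤-refl
indicator≤1 false = z≤n

count-suc : ∀ {n} (p : Fin (suc n) → Bool) →
            count p ≡ indicator (p zero) + count (p ∘ suc)
count-suc {n} p = cong (indicator (p zero) +_) (cong sum (begin
  map (indicator ∘ p) (tabulate suc)      ≡⟨ map-tabulate suc (indicator ∘ p) ⟩
  tabulate (indicator ∘ p ∘ suc)          ≡⟨ map-tabulate id (indicator ∘ p ∘ suc) ⟨
  map (indicator ∘ p ∘ suc) (allFin n)    ∎))
  where open ≡-Reasoning

count-cong : ∀ {n} {p q : Fin n → Bool} → (∀ u → p u ≡ q u) → count p ≡ count q
count-cong {n} p≗q = cong sum (map-cong (cong indicator ∘ p≗q) (allFin n))

count-≤-suc : ∀ {n} (v : Fin n) {p q : Fin n → Bool} →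
              (∀ u → u ≢ v → p u ≡ q u) → count p ≤ suc (count q)
count-≤-suc {suc n} zero {p} {q} agree = begin
  count p                                      ≡⟨ count-suc p ⟩
  indicator (p zero) + count (p ∘ suc)         ≡⟨ cong (indicator (p zero) +_)
                                                    (count-cong (λ u → agree (suc u) λ ())) ⟩
  indicator (p zero) + count (q ∘ suc)         ≤⟨ m≤1⇒m+n≤1+n (indicator≤1 (p zero)) ⟩
  suc (count (q ∘ suc))                        ≤⟨ s≤s (m≤n+m _ (indicator (q zero))) ⟩
  suc (indicator (q zero) + count (q ∘ suc))   ≡⟨ cong suc (count-suc q) ⟨
  suc (count q)                                ∎
  where
  open ≤-Reasoning
  m≤1⇒m+n≤1+n : ∀ {a c} → a ≤ 1 → a + c ≤ suc c
  m≤1⇒m+n≤1+n z≤n       = n≤1+n _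
  m≤1⇒m+n≤1+n (s≤s z≤n) = ≤-refl
count-≤-suc {suc n} (suc v) {p} {q} agree = begin
  count p                                      ≡⟨ count-suc p ⟩
  indicator (p zero) + count (p ∘ suc)         ≡⟨ cong (λ b → indicator b + count (p ∘ suc))
                                                    (agree zero λ ()) ⟩
  indicator (q zero) + count (p ∘ suc)         ≤⟨ +-monoʳ-≤ (indicator (q zero)) (count-≤-suc v
                                                    λ u u≢v → agree (suc u) (u≢v ∘ suc-injective)) ⟩
  indicator (q zero) + suc (count (q ∘ suc))   ≡⟨ +-suc (indicator (q zero)) _ ⟩
  suc (indicator (q zero) + count (q ∘ suc))   ≡⟨ cong suc (count-suc q) ⟨
  suc (count q)                                ∎
  where open ≤-Reasoning

m≤1+n∧n≤1+m⇒∣m-n∣≤1 : ∀ {m n} → m ≤ suc n → n ≤ suc m → ∣ m - n ∣ ≤ 1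
m≤1+n∧n≤1+m⇒∣m-n∣≤1 {zero}  {zero}  _         _         = z≤n
m≤1+n∧n≤1+m⇒∣m-n∣≤1 {zero}  {suc n} _         n≤1       = n≤1
m≤1+n∧n≤1+m⇒∣m-n∣≤1 {suc m} {zero}  m≤1       _         = m≤1
m≤1+n∧n≤1+m⇒∣m-n∣≤1 {suc m} {suc n} (s≤s m≤n) (s≤s n≤m) = m≤1+n∧n≤1+m⇒∣m-n∣≤1 m≤n n≤m

∣count-count∣≤1 : ∀ {n} (v : Fin n) {p q : Fin n → Bool} →
                  (∀ u → u ≢ v → p u ≡ q u) → ∣ count p - count q ∣ ≤ 1
∣count-count∣≤1 v agree = m≤1+n∧n≤1+m⇒∣m-n∣≤1
  (count-≤-suc v agree) (count-≤-suc v λ u u≢v → sym (agree u u≢v))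

AgreeAwayFrom : ∀ {n} → Fin n → Graph n → Graph n → Set
AgreeAwayFrom v G G' = ∀ a b → a ≢ v → b ≢ v → adj G a b ≡ adj G' a b

-- Taking u = a in the neighbouring condition: the extra edge {v,a} cannot be
-- {a,b} since neither endpoint is v.
neighboring⇒agreeAwayFrom : ∀ {n} {isP : Fin n → Bool} {G G' : Graph n}
  (G∼G' : Neighboring isP G G') → AgreeAwayFrom (proj₁ G∼G') G G'
neighboring⇒agreeAwayFrom {G = G} {G'} (v , _ , D≈D') a b a≢v b≢v =
  ⇔→≡ (mk⇔ (transport G G' (Equivalence.to (D≈D' a a≢v a b)))
            (transport G' G (Equivalence.from (D≈D' a a≢v a b))))
  where
  notExtra : ¬ SameEdge a b v a
  notExtra (inj₁ (a≡v , _)) = a≢v a≡v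
  notExtra (inj₂ (_ , b≡v)) = b≢v b≡v
  transport : ∀ H H' → (InD H a a b ⊎ SameEdge a b v a →
                        InD H' a a b ⊎ SameEdge a b v a) →
              adj H a b ≡ true → adj H' a b ≡ true
  transport H H' to ab∈H with to (inj₁ (ab∈H , inj₁ refl))
  ... | inj₁ (ab∈H' , _) = ab∈H'
  ... | inj₂ extra       = ⊥-elim (notExtra extra)

IsCommonNeighbour : ∀ {n} → Graph n → Fin n → (Fin n → Bool) → Fin n → Bool
IsCommonNeighbour {n} G t S u = adj G t u ∧ any (λ v' → S v' ∧ adj G u v') (allFin n)

isCommonNeighbour-agree : ∀ {n} {v : Fin n} {G G' : Graph n} → AgreeAwayFrom v G G' →
  ∀ t (S : Fin n → Bool) → t ≢ v → (∀ x → S x ≡ true → x ≢ v) →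
  ∀ u → u ≢ v → IsCommonNeighbour G t S u ≡ IsCommonNeighbour G' t S u
isCommonNeighbour-agree {n} {G = G} {G'} agree t S t≢v S∌v u u≢v =
  cong₂ _∧_ (agree t u t≢v u≢v) (cong or (map-cong viaS (allFin n)))
  where
  viaS : ∀ v' → (S v' ∧ adj G u v') ≡ (S v' ∧ adj G' u v')
  viaS v' with S v' in Sv'
  ... | false = refl
  ... | true  = agree u v' u≢v (S∌v v' Sv')

lemma9 : (n : ℕ) (isP : Fin n → Bool) (G G' : Graph n) →
    Neighboring isP G G' →
    (t : Fin n) → isP t ≡ false →
    (S : Fin n → Bool) → SubsetOfT isP S →
    ∣ CN G t S - CN G' t S ∣ ≤ 1
lemma9 n isP G G' G∼G'@(v , v∈P , _) t t∈T S S⊆T =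
  ∣count-count∣≤1 v
    (isCommonNeighbour-agree {G = G} {G'} G≈G' t S (∉P⇒≢v t∈T) (λ x → ∉P⇒≢v ∘ S⊆T x))
  where
  G≈G' : AgreeAwayFrom v G G'
  G≈G' = neighboring⇒agreeAwayFrom {isP = isP} {G} {G'} G∼G'
  ∉P⇒≢v : ∀ {x} → isP x ≡ false → x ≢ v
  ∉P⇒≢v x∉P refl with trans (sym x∉P) v∈P
  ... | ()
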